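{- For $G=\mathbb Z_3\times\mathbb Z_3$, $$\mathcal S(G)=\{9m\pm 1 : m\in\mathbb Z\}\cup\{3^6m : m\in\mathbb Z\}.$$
   Context: For a finite group $G=\{g_1,\dots,g_n\}$, assign an independent variable $x_g$ to each $g\in G$; the group determinant $\mathscr D_G(x_{g_1},\dots,x_{g_n})$ is the determinant of the $n\times n$ matrix whose $(i,j)$ entry is $x_{g_ig_j^{ -1}}$. Define $\mathcal S(G)=\{\mathscr D_G(x_{g_1},\dots,x_{g_n}) : x_{g_i}\in\mathbb Z\}$. -}

module Defs where

open import Data.Nat using (ℕ; zero; suc)
open import Data.Fin using (Fin; zero; suc; punchIn; toℕ; fromℕ<)
open import Data.Fin.Properties using ()
open import Data.Integer using (ℤ; +_; -_; _+_; _*_; _-_)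
open import Data.Product using (_×_; _,_; proj₁; proj₂; ∃; ∃-syntax)
open import Data.Sum using (_⊎_)
open import Function.Bundles using (_⇔_)
open import Relation.Binary.PropositionalEquality using (_≡_)

sign : ℕ → ℤ
sign zero = + 1
sign (suc zero) = - (+ 1)
sign (suc (suc k)) = sign k

Σ : (n : ℕ) → (Fin n → ℤ) → ℤ
Σ zero f = + 0
Σ (suc n) f = f zero + Σ n (λ i → f (suc i))

det : (n : ℕ) → (Fin n → Fin n → ℤ) → ℤ
det zero M = + 1
det (suc n) M =
  Σ (suc n) (λ j → sign (toℕ j) * (M zero j * det n (λ r c → M (suc r) (punchIn j c))))

Z3 : Set
Z3 = Fin 3

_+₃_ : Z3 → Z3 → Z3
zero +₃ b = b
suc zero +₃ zero = suc zero
suc zero +₃ suc zero = suc (suc zero)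
suc zero +₃ suc (suc zero) = zero
suc (suc zero) +₃ zero = suc (suc zero)
suc (suc zero) +₃ suc zero = zero
suc (suc zero) +₃ suc (suc zero) = suc zero

neg₃ : Z3 → Z3
neg₃ zero = zero
neg₃ (suc zero) = suc (suc zero)
neg₃ (suc (suc zero)) = suc zero

G : Set
G = Z3 × Z3

_·_ : G → G → G
(a , b) · (c , d) = (a +₃ c , b +₃ d)

_⁻¹ : G → G
(a , b) ⁻¹ = (neg₃ a , neg₃ b)

-- An enumeration g_1..g_9 of G (a bijection Fin 9 → G; the determinant does not
-- depend on the chosen ordering).
enum : Fin 9 → G
enum i = (q i , r i)
  where
  q : Fin 9 → Z3
  q zero = zero
  q (suc zero) = zero
  q (suc (suc zero)) = zero
  q (suc (suc (suc zero))) = suc zero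
  q (suc (suc (suc (suc zero)))) = suc zero
  q (suc (suc (suc (suc (suc zero))))) = suc zero
  q (suc (suc (suc (suc (suc (suc _)))))) = suc (suc zero)
  r : Fin 9 → Z3
  r zero = zero
  r (suc zero) = suc zero
  r (suc (suc zero)) = suc (suc zero)
  r (suc (suc (suc zero))) = zero
  r (suc (suc (suc (suc zero)))) = suc zero
  r (suc (suc (suc (suc (suc zero))))) = suc (suc zero)
  r (suc (suc (suc (suc (suc (suc zero)))))) = zero
  r (suc (suc (suc (suc (suc (suc (suc zero))))))) = suc zero
  r (suc (suc (suc (suc (suc (suc (suc (suc zero)))))))) = suc (suc zero)

groupDet : (G → ℤ) → ℤ
groupDet x = det 9 (λ i j → x (enum i · (enum j ⁻¹)))

InS : ℤ → Set
InS d = ∃[ x ] groupDet x ≡ d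

-- The group determinant of an abelian group factors into the linear forms
-- Σ_g χ(g) x_g over its characters χ.  For Z₃ × Z₃, pairing each non-trivial character
-- with its conjugate gives
--   D = s · N₁ N₂ N₃ N₄,   N_H = a² + b² + c² − ab − bc − ca = s² − 3 e_H,
-- where H runs over the four subgroups of order 3 ("lines"), a, b, c are the sums of x
-- over the three cosets of H, s = Σ_g x_g and e_H = ab + bc + ca; here this identity is
-- verified by computing the determinant symbolically.  Two distinct elements share a
-- coset of exactly one line, so Σ_H e_H = 3 Σ_{g<h} x_g x_h ≡ 0 (mod 3).
-- If 3 ∤ s, expanding the product gives D ≡ s⁹ − 3s⁷ Σ_H e_H ≡ s⁹ ≡ ±1 (mod 9).
-- If 3 ∣ s, every N_H is divisible by 3, and e_H ≡ −(a − b)² ∈ {0, −1} (mod 3); the four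
-- e_H cannot all be −1, so some N_H is divisible by 9 and 3⁶ ∣ D.
-- Conversely, translating x by a constant q adds 9q to s and fixes every N_H, so a few
-- small vectors and their translates realise all of 9m ± 1 and 729m.

module Submission where

open import Defs
open import Algebra.Bundles.Raw using (RawRing)
open import Data.Bool using (Bool; true; false; _∧_)
open import Data.Empty using (⊥; ⊥-elim)
open import Data.Fin using (Fin; zero; suc; punchIn; toℕ)
open import Data.Integer using (ℤ; +_; ∣_∣; 0ℤ; 1ℤ; -1ℤ; +-*-rawRing)
open import Data.Integer.DivMod using (_%ℕ_; _/ℕ_; n%ℕd<d; a≡a%ℕn+[a/ℕn]*n)
open import Data.Integer.Divisibility.Signed using (divides; _∣?_)
open import Data.Integer.Properties using (+-identityˡ; +-identityʳ; *-identityʳ; *-zeroʳ; suc-*)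
open import Data.Integer.Tactic.RingSolver using (solve-∀)
open import Data.Nat using (ℕ; zero; suc; s≤s; NonZero)
open import Data.Product using (_×_; _,_; ∃-syntax)
open import Data.Sum using (_⊎_; inj₁; inj₂)
open import Data.Vec using (Vec; []; _∷_; lookup; tabulate; removeAt; allFin)
open import Data.Vec.Properties using (lookup∘tabulate; lookup-allFin)
open import Function using (_∘_; case_of_)
open import Function.Bundles using (_⇔_; mk⇔)
open import Function.Strict using (force; force-≡)
open import Level using (0ℓ)
open import Relation.Nullary.Decidable using (from-no)
open import Relation.Binary.PropositionalEquality
  using (_≡_; refl; sym; trans; cong; cong₂; subst; module ≡-Reasoning)

private
  variable
    v n : ℕ

-- Lines and coset sums

𝟙 : G
𝟙 = zero , zero

-- A line is a subgroup of order 3, generated by its direction; its cosets are those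
-- of 𝟙, t and t · t, where t is its transversal.
data Line : Set where
  line₀₁ line₁₀ line₁₁ line₁₂ : Line

direction transversal : Line → G
direction line₀₁ = zero , suc zero
direction line₁₀ = suc zero , zero
direction line₁₁ = suc zero , suc zero
direction line₁₂ = suc zero , suc (suc zero)
transversal line₀₁ = suc zero , zero
transversal line₁₀ = zero , suc zero
transversal line₁₁ = zero , suc zero
transversal line₁₂ = zero , suc zero

-- Written once over an arbitrary ring signature, and read both in ℤ and in Expr.
module CosetFormulas (R : RawRing 0ℓ 0ℓ) where
  open RawRing R renaming (Carrier to A)

  sum : (n : ℕ) → (Fin n → A) → A
  sum zero f = 0#
  sum (suc n) f = f zero + sum n (f ∘ suc)

  σ₂ : A → A → A → A
  σ₂ a b c = a * b + b * c + c * a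

  norm : A → A → A → A
  norm a b c = a * a + b * b + c * c + - σ₂ a b c

  total : (G → A) → A
  total x = sum 9 (x ∘ enum)

  cosetSum : (G → A) → Line → G → A
  cosetSum x ℓ g = x g + x (g · direction ℓ) + x ((g · direction ℓ) · direction ℓ)

  atCosetSums : (G → A) → Line → (A → A → A → A) → A
  atCosetSums x ℓ f =
    f (cosetSum x ℓ 𝟙) (cosetSum x ℓ (transversal ℓ)) (cosetSum x ℓ (transversal ℓ · transversal ℓ))

  lineSum lineNorm lineσ₂ : (G → A) → Line → A
  lineSum x ℓ = atCosetSums x ℓ (λ a b c → a + b + c)
  lineNorm x ℓ = atCosetSums x ℓ norm
  lineσ₂ x ℓ = atCosetSums x ℓ σ₂

  lineNormProduct lineσ₂Sum : (G → A) → A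
  lineNormProduct x = lineNorm x line₀₁ * (lineNorm x line₁₀ * (lineNorm x line₁₁ * lineNorm x line₁₂))
  lineσ₂Sum x = lineσ₂ x line₀₁ + lineσ₂ x line₁₀ + lineσ₂ x line₁₁ + lineσ₂ x line₁₂

  pairSum : (n : ℕ) → (Fin n → A) → A
  pairSum zero f = 0#
  pairSum (suc n) f = f zero * sum n (f ∘ suc) + pairSum n (f ∘ suc)

-- Imported only here, since CosetFormulas uses the same names for its ring operations.
open import Data.Integer using (-_; _+_; _*_; _-_)

-- Polynomial normal forms

-- Sparse Horner form in the variables x₀ … x₍ₙ₋₁₎: a ∷ p stands for a + x₀ · p,
-- where a does not involve x₀.
infixr 5 _∷_
data Poly : ℕ → Set where
  ⟨_⟩ : ℤ → Poly zero
  [] : Poly (suc n)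
  _∷_ : Poly n → Poly (suc n) → Poly (suc n)

⟦_⟧ₚ : Poly n → Vec ℤ n → ℤ
⟦ ⟨ a ⟩ ⟧ₚ [] = a
⟦ [] ⟧ₚ _ = 0ℤ
⟦ a ∷ p ⟧ₚ (x ∷ ρ) = ⟦ a ⟧ₚ ρ + x * ⟦ p ⟧ₚ (x ∷ ρ)

-- The operations build their results eagerly; this is what makes the closed
-- normalisation in factorisation-check below feasible.
⟨_⟩! : ℤ → Poly zero
⟨ r ⟩! = force r (λ r′ → force ∣ r′ ∣ (λ _ → ⟨ r′ ⟩))

infixr 5 _∷!_
_∷!_ : Poly n → Poly (suc n) → Poly (suc n)
a ∷! p = force a (λ a′ → force p (λ p′ → a′ ∷ p′))

0ₚ : Poly n
0ₚ {zero} = ⟨ 0ℤ ⟩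
0ₚ {suc n} = []

constₚ : ℤ → Poly n
constₚ {zero} z = ⟨ z ⟩
constₚ {suc n} z = constₚ z ∷ []

varₚ : Fin n → Poly n
varₚ zero = 0ₚ ∷ constₚ 1ℤ ∷ []
varₚ (suc k) = varₚ k ∷ []

infixl 6 _+ₚ_ _-ₚ_
infixl 7 _*ₚ_

_+ₚ_ : Poly n → Poly n → Poly n
⟨ a ⟩ +ₚ ⟨ b ⟩ = ⟨ a + b ⟩!
[] +ₚ q = q
(a ∷ p) +ₚ [] = a ∷ p
(a ∷ p) +ₚ (b ∷ q) = (a +ₚ b) ∷! (p +ₚ q)

-ₚ_ : Poly n → Poly n
-ₚ ⟨ a ⟩ = ⟨ - a ⟩!
-ₚ [] = []
-ₚ (a ∷ p) = (-ₚ a) ∷! (-ₚ p)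

_-ₚ_ : Poly n → Poly n → Poly n
p -ₚ q = p +ₚ -ₚ q

mulVarₚ : Poly (suc n) → Poly (suc n)
mulVarₚ [] = []
mulVarₚ (a ∷ p) = 0ₚ ∷ a ∷ p

mutual
  _*ₚ_ : Poly n → Poly n → Poly n
  ⟨ a ⟩ *ₚ ⟨ b ⟩ = ⟨ a * b ⟩!
  [] *ₚ q = []
  (a ∷ p) *ₚ q = scaleₚ a q +ₚ mulVarₚ (p *ₚ q)

  scaleₚ : Poly n → Poly (suc n) → Poly (suc n)
  scaleₚ a [] = []
  scaleₚ a (b ∷ q) = (a *ₚ b) ∷! scaleₚ a q

isZeroₚ : Poly n → Bool
isZeroₚ ⟨ + zero ⟩ = true
isZeroₚ ⟨ _ ⟩ = false
isZeroₚ [] = true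
isZeroₚ (a ∷ p) = isZeroₚ a ∧ isZeroₚ p

∷!-≡ : (a : Poly n) (p : Poly (suc n)) → a ∷! p ≡ a ∷ p
∷!-≡ a p = trans (force-≡ a _) (force-≡ p _)

⟨⟩!-≡ : ∀ r → ⟨ r ⟩! ≡ ⟨ r ⟩
⟨⟩!-≡ r = trans (force-≡ r _) (force-≡ ∣ r ∣ _)

0ₚ-correct : (ρ : Vec ℤ n) → ⟦ 0ₚ {n} ⟧ₚ ρ ≡ 0ℤ
0ₚ-correct [] = refl
0ₚ-correct (x ∷ ρ) = refl

constₚ-correct : ∀ z (ρ : Vec ℤ n) → ⟦ constₚ z ⟧ₚ ρ ≡ z
constₚ-correct z [] = refl
constₚ-correct z (x ∷ ρ) rewrite constₚ-correct z ρ | *-zeroʳ x = +-identityʳ z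

varₚ-correct : ∀ (k : Fin n) ρ → ⟦ varₚ k ⟧ₚ ρ ≡ lookup ρ k
varₚ-correct zero (x ∷ ρ) rewrite 0ₚ-correct ρ | constₚ-correct 1ℤ ρ = horner-var x
  where
  horner-var : ∀ x → 0ℤ + x * (1ℤ + x * 0ℤ) ≡ x
  horner-var = solve-∀
varₚ-correct (suc k) (x ∷ ρ) rewrite varₚ-correct k ρ | *-zeroʳ x = +-identityʳ _

+ₚ-homo : ∀ (p q : Poly n) ρ → ⟦ p +ₚ q ⟧ₚ ρ ≡ ⟦ p ⟧ₚ ρ + ⟦ q ⟧ₚ ρ
+ₚ-homo ⟨ a ⟩ ⟨ b ⟩ [] rewrite ⟨⟩!-≡ (a + b) = refl
+ₚ-homo [] q (x ∷ ρ) = sym (+-identityˡ _)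
+ₚ-homo (a ∷ p) [] (x ∷ ρ) = sym (+-identityʳ _)
+ₚ-homo (a ∷ p) (b ∷ q) (x ∷ ρ)
  rewrite ∷!-≡ (a +ₚ b) (p +ₚ q) | +ₚ-homo a b ρ | +ₚ-homo p q (x ∷ ρ) =
  interchange (⟦ a ⟧ₚ ρ) (⟦ b ⟧ₚ ρ) (⟦ p ⟧ₚ (x ∷ ρ)) (⟦ q ⟧ₚ (x ∷ ρ)) x
  where
  interchange : ∀ a b p q x → (a + b) + x * (p + q) ≡ (a + x * p) + (b + x * q)
  interchange = solve-∀

-ₚ-homo : ∀ (p : Poly n) ρ → ⟦ -ₚ p ⟧ₚ ρ ≡ - ⟦ p ⟧ₚ ρ
-ₚ-homo ⟨ a ⟩ [] rewrite ⟨⟩!-≡ (- a) = refl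
-ₚ-homo [] (x ∷ ρ) = refl
-ₚ-homo (a ∷ p) (x ∷ ρ)
  rewrite ∷!-≡ (-ₚ a) (-ₚ p) | -ₚ-homo a ρ | -ₚ-homo p (x ∷ ρ) =
  neg-horner (⟦ a ⟧ₚ ρ) (⟦ p ⟧ₚ (x ∷ ρ)) x
  where
  neg-horner : ∀ a p x → - a + x * - p ≡ - (a + x * p)
  neg-horner = solve-∀

mulVarₚ-homo : ∀ (p : Poly (suc n)) x ρ → ⟦ mulVarₚ p ⟧ₚ (x ∷ ρ) ≡ x * ⟦ p ⟧ₚ (x ∷ ρ)
mulVarₚ-homo [] x ρ = sym (*-zeroʳ x)
mulVarₚ-homo (a ∷ p) x ρ rewrite 0ₚ-correct ρ = +-identityˡ _

mutual
  *ₚ-homo : ∀ (p q : Poly n) ρ → ⟦ p *ₚ q ⟧ₚ ρ ≡ ⟦ p ⟧ₚ ρ * ⟦ q ⟧ₚ ρ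
  *ₚ-homo ⟨ a ⟩ ⟨ b ⟩ [] rewrite ⟨⟩!-≡ (a * b) = refl
  *ₚ-homo [] q (x ∷ ρ) = refl
  *ₚ-homo (a ∷ p) q (x ∷ ρ)
    rewrite +ₚ-homo (scaleₚ a q) (mulVarₚ (p *ₚ q)) (x ∷ ρ)
          | scaleₚ-homo a q x ρ | mulVarₚ-homo (p *ₚ q) x ρ | *ₚ-homo p q (x ∷ ρ) =
    horner-distrib (⟦ a ⟧ₚ ρ) (⟦ p ⟧ₚ (x ∷ ρ)) (⟦ q ⟧ₚ (x ∷ ρ)) x
    where
    horner-distrib : ∀ a p q x → a * q + x * (p * q) ≡ (a + x * p) * q
    horner-distrib = solve-∀

  scaleₚ-homo : ∀ (a : Poly n) q x ρ → ⟦ scaleₚ a q ⟧ₚ (x ∷ ρ) ≡ ⟦ a ⟧ₚ ρ * ⟦ q ⟧ₚ (x ∷ ρ)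
  scaleₚ-homo a [] x ρ = sym (*-zeroʳ (⟦ a ⟧ₚ ρ))
  scaleₚ-homo a (b ∷ q) x ρ
    rewrite ∷!-≡ (a *ₚ b) (scaleₚ a q) | *ₚ-homo a b ρ | scaleₚ-homo a q x ρ =
    horner-scale (⟦ a ⟧ₚ ρ) (⟦ b ⟧ₚ ρ) (⟦ q ⟧ₚ (x ∷ ρ)) x
    where
    horner-scale : ∀ a b q x → a * b + x * (a * q) ≡ a * (b + x * q)
    horner-scale = solve-∀

isZeroₚ-sound : ∀ (p : Poly n) → isZeroₚ p ≡ true → ∀ ρ → ⟦ p ⟧ₚ ρ ≡ 0ℤ
isZeroₚ-sound ⟨ + zero ⟩ _ [] = refl
isZeroₚ-sound [] _ (x ∷ ρ) = refl
isZeroₚ-sound (a ∷ p) p≈0 (x ∷ ρ)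
  with isZeroₚ a in a≈0 | isZeroₚ p in p′≈0
isZeroₚ-sound (a ∷ p) refl (x ∷ ρ) | true | true
  rewrite isZeroₚ-sound a a≈0 ρ | isZeroₚ-sound p p′≈0 (x ∷ ρ) | *-zeroʳ x = refl

-- Normal forms are not canonical (trailing zero coefficients), so an identity is
-- checked by testing the difference for zero.
poly-identity : ∀ (p q : Poly n) → isZeroₚ (p -ₚ q) ≡ true → ∀ ρ → ⟦ p ⟧ₚ ρ ≡ ⟦ q ⟧ₚ ρ
poly-identity p q p-q≈0 ρ = begin
  ⟦ p ⟧ₚ ρ                       ≡⟨ cancel (⟦ p ⟧ₚ ρ) (⟦ q ⟧ₚ ρ) ⟩
  ⟦ p ⟧ₚ ρ + - ⟦ q ⟧ₚ ρ + ⟦ q ⟧ₚ ρ ≡⟨ cong (_+ ⟦ q ⟧ₚ ρ) difference≡0 ⟩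
  0ℤ + ⟦ q ⟧ₚ ρ                  ≡⟨ +-identityˡ _ ⟩
  ⟦ q ⟧ₚ ρ                       ∎
  where
  open ≡-Reasoning
  cancel : ∀ a b → a ≡ a + - b + b
  cancel = solve-∀
  difference≡0 : ⟦ p ⟧ₚ ρ + - ⟦ q ⟧ₚ ρ ≡ 0ℤ
  difference≡0 = begin
    ⟦ p ⟧ₚ ρ + - ⟦ q ⟧ₚ ρ ≡⟨ cong (λ z → ⟦ p ⟧ₚ ρ + z) (-ₚ-homo q ρ) ⟨
    ⟦ p ⟧ₚ ρ + ⟦ -ₚ q ⟧ₚ ρ ≡⟨ +ₚ-homo p (-ₚ q) ρ ⟨
    ⟦ p -ₚ q ⟧ₚ ρ         ≡⟨ isZeroₚ-sound (p -ₚ q) p-q≈0 ρ ⟩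
    0ℤ                    ∎

-- Determinants of polynomial matrices

minor : ∀ {A : Set} → (Fin (suc n) → Fin (suc n) → A) → Fin (suc n) → Fin n → Fin n → A
minor M j r c = M (suc r) (punchIn j c)

Σₚ : (n : ℕ) → (Fin n → Poly v) → Poly v
Σₚ zero f = 0ₚ
Σₚ (suc n) f = f zero +ₚ Σₚ n (f ∘ suc)

detₚ : (n : ℕ) → (Fin n → Fin n → Poly v) → Poly v
detₚ zero M = constₚ 1ℤ
detₚ (suc n) M = Σₚ (suc n) (λ j → constₚ (sign (toℕ j)) *ₚ (M zero j *ₚ detₚ n (minor M j)))

Σ-cong : ∀ n {f g : Fin n → ℤ} → (∀ i → f i ≡ g i) → Σ n f ≡ Σ n g
Σ-cong zero f≗g = refl
Σ-cong (suc n) f≗g = cong₂ _+_ (f≗g zero) (Σ-cong n (f≗g ∘ suc))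

Σₚ-cong : ∀ n {f g : Fin n → Poly v} → (∀ i → f i ≡ g i) → Σₚ n f ≡ Σₚ n g
Σₚ-cong zero f≗g = refl
Σₚ-cong (suc n) f≗g = cong₂ _+ₚ_ (f≗g zero) (Σₚ-cong n (f≗g ∘ suc))

det-cong : ∀ n {M N : Fin n → Fin n → ℤ} → (∀ i j → M i j ≡ N i j) → det n M ≡ det n N
det-cong zero M≗N = refl
det-cong (suc n) M≗N = Σ-cong (suc n) λ j →
  cong₂ (λ a b → sign (toℕ j) * (a * b)) (M≗N zero j) (det-cong n (λ r c → M≗N (suc r) (punchIn j c)))

detₚ-cong : ∀ n {M N : Fin n → Fin n → Poly v} → (∀ i j → M i j ≡ N i j) → detₚ n M ≡ detₚ n N
detₚ-cong zero M≗N = refl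
detₚ-cong (suc n) M≗N = Σₚ-cong (suc n) λ j →
  cong₂ (λ a b → constₚ (sign (toℕ j)) *ₚ (a *ₚ b)) (M≗N zero j)
        (detₚ-cong n (λ r c → M≗N (suc r) (punchIn j c)))

Σₚ-homo : ∀ n (f : Fin n → Poly v) ρ → ⟦ Σₚ n f ⟧ₚ ρ ≡ Σ n (λ i → ⟦ f i ⟧ₚ ρ)
Σₚ-homo zero f ρ = 0ₚ-correct ρ
Σₚ-homo (suc n) f ρ rewrite +ₚ-homo (f zero) (Σₚ n (f ∘ suc)) ρ | Σₚ-homo n (f ∘ suc) ρ = refl

detₚ-homo : ∀ n (M : Fin n → Fin n → Poly v) ρ → ⟦ detₚ n M ⟧ₚ ρ ≡ det n (λ i j → ⟦ M i j ⟧ₚ ρ)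
detₚ-homo zero M ρ = constₚ-correct 1ℤ ρ
detₚ-homo (suc n) M ρ =
  trans (Σₚ-homo (suc n) (λ j → constₚ (sign (toℕ j)) *ₚ (M zero j *ₚ detₚ n (minor M j))) ρ)
        (Σ-cong (suc n) term-homo)
  where
  term-homo : ∀ j → ⟦ constₚ (sign (toℕ j)) *ₚ (M zero j *ₚ detₚ n (minor M j)) ⟧ₚ ρ
                  ≡ sign (toℕ j) * (⟦ M zero j ⟧ₚ ρ * det n (λ r c → ⟦ minor M j r c ⟧ₚ ρ))
  term-homo j
    rewrite *ₚ-homo (constₚ (sign (toℕ j))) (M zero j *ₚ detₚ n (minor M j)) ρ
          | constₚ-correct (sign (toℕ j)) ρ
          | *ₚ-homo (M zero j) (detₚ n (minor M j)) ρ
          | detₚ-homo n (minor M j) ρ = refl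

lookup-removeAt : ∀ {A : Set} (xs : Vec A (suc n)) i j → lookup (removeAt xs i) j ≡ lookup xs (punchIn i j)
lookup-removeAt (x ∷ xs) zero j = refl
lookup-removeAt (x ∷ y ∷ xs) (suc i) zero = refl
lookup-removeAt (x ∷ y ∷ xs) (suc i) (suc j) = lookup-removeAt (y ∷ xs) i j

-- Laplace expansion with memoised minors: entry cs of minorTable M k rs is the
-- determinant of the k×k submatrix of M with rows rs and columns cs.
Table : ℕ → ℕ → ℕ → Set
Table v n zero = Poly v
Table v n (suc k) = Vec (Table v n k) n

tabulateT : ∀ k → (Vec (Fin n) k → Poly v) → Table v n k
tabulateT zero f = f []
tabulateT (suc k) f = tabulate (λ c → tabulateT k (f ∘ (c ∷_)))

lookupT : ∀ {k} → Table v n k → Vec (Fin n) k → Poly v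
lookupT {k = zero} t [] = t
lookupT {k = suc k} t (c ∷ cs) = lookupT (lookup t c) cs

lookupT-tabulateT : ∀ k (f : Vec (Fin n) k → Poly v) cs → lookupT (tabulateT k f) cs ≡ f cs
lookupT-tabulateT zero f [] = refl
lookupT-tabulateT (suc k) f (c ∷ cs)
  rewrite lookup∘tabulate (λ c → tabulateT k (f ∘ (c ∷_))) c = lookupT-tabulateT k (f ∘ (c ∷_)) cs

-- The smaller table is an argument, hence shared by all entries of the new one.
expandRow : (Fin n → Fin n → Poly v) → ∀ k → Fin n → Table v n k → Table v n (suc k)
expandRow M k r t = tabulateT (suc k) λ cs →
  Σₚ (suc k) (λ j → constₚ (sign (toℕ j)) *ₚ (M r (lookup cs j) *ₚ lookupT t (removeAt cs j)))

minorTable : (Fin n → Fin n → Poly v) → ∀ k → Vec (Fin n) k → Table v n k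
minorTable M zero [] = constₚ 1ℤ
minorTable M (suc k) (r ∷ rs) = expandRow M k r (minorTable M k rs)

lookup-minorTable : ∀ (M : Fin n → Fin n → Poly v) k rs cs →
  lookupT (minorTable M k rs) cs ≡ detₚ k (λ i j → M (lookup rs i) (lookup cs j))
lookup-minorTable M zero [] [] = refl
lookup-minorTable M (suc k) (r ∷ rs) cs =
  trans (lookupT-tabulateT (suc k) (λ cs → Σₚ (suc k) (λ j →
           constₚ (sign (toℕ j)) *ₚ (M r (lookup cs j) *ₚ lookupT (minorTable M k rs) (removeAt cs j)))) cs)
        (Σₚ-cong (suc k) λ j →
    cong (λ m → constₚ (sign (toℕ j)) *ₚ (M r (lookup cs j) *ₚ m))
      (trans (lookup-minorTable M k rs (removeAt cs j))
             (detₚ-cong k (λ a b → cong (M (lookup rs a)) (lookup-removeAt cs j b)))))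

detₘ : (n : ℕ) → (Fin n → Fin n → Poly v) → Poly v
detₘ n M = lookupT (minorTable M n (allFin n)) (allFin n)

detₘ≡detₚ : ∀ n (M : Fin n → Fin n → Poly v) → detₘ n M ≡ detₚ n M
detₘ≡detₚ n M = trans (lookup-minorTable M n (allFin n) (allFin n))
  (detₚ-cong n (λ i j → cong₂ M (lookup-allFin i) (lookup-allFin j)))

detₘ-homo : ∀ n (M : Fin n → Fin n → Poly v) ρ → ⟦ detₘ n M ⟧ₚ ρ ≡ det n (λ i j → ⟦ M i j ⟧ₚ ρ)
detₘ-homo n M ρ = trans (cong (λ p → ⟦ p ⟧ₚ ρ) (detₘ≡detₚ n M)) (detₚ-homo n M ρ)

infixl 6 _⊕_
infixl 7 _⊗_
data Expr (n : ℕ) : Set where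
  var : Fin n → Expr n
  lit : ℤ → Expr n
  _⊕_ _⊗_ : Expr n → Expr n → Expr n
  ⊝_ : Expr n → Expr n

⟦_⟧ₑ : Expr n → Vec ℤ n → ℤ
⟦ var i ⟧ₑ ρ = lookup ρ i
⟦ lit z ⟧ₑ ρ = z
⟦ e ⊕ f ⟧ₑ ρ = ⟦ e ⟧ₑ ρ + ⟦ f ⟧ₑ ρ
⟦ e ⊗ f ⟧ₑ ρ = ⟦ e ⟧ₑ ρ * ⟦ f ⟧ₑ ρ
⟦ ⊝ e ⟧ₑ ρ = - ⟦ e ⟧ₑ ρ

toPoly : Expr n → Poly n
toPoly (var i) = varₚ i
toPoly (lit z) = constₚ z
toPoly (e ⊕ f) = toPoly e +ₚ toPoly f
toPoly (e ⊗ f) = toPoly e *ₚ toPoly f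
toPoly (⊝ e) = -ₚ toPoly e

toPoly-correct : ∀ (e : Expr n) ρ → ⟦ toPoly e ⟧ₚ ρ ≡ ⟦ e ⟧ₑ ρ
toPoly-correct (var i) ρ = varₚ-correct i ρ
toPoly-correct (lit z) ρ = constₚ-correct z ρ
toPoly-correct (e ⊕ f) ρ
  rewrite +ₚ-homo (toPoly e) (toPoly f) ρ | toPoly-correct e ρ | toPoly-correct f ρ = refl
toPoly-correct (e ⊗ f) ρ
  rewrite *ₚ-homo (toPoly e) (toPoly f) ρ | toPoly-correct e ρ | toPoly-correct f ρ = refl
toPoly-correct (⊝ e) ρ rewrite -ₚ-homo (toPoly e) ρ | toPoly-correct e ρ = refl

expr-identity : ∀ (e f : Expr n) → isZeroₚ (toPoly e -ₚ toPoly f) ≡ true → ∀ ρ → ⟦ e ⟧ₑ ρ ≡ ⟦ f ⟧ₑ ρ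
expr-identity e f e-f≈0 ρ = begin
  ⟦ e ⟧ₑ ρ          ≡⟨ toPoly-correct e ρ ⟨
  ⟦ toPoly e ⟧ₚ ρ   ≡⟨ poly-identity (toPoly e) (toPoly f) e-f≈0 ρ ⟩
  ⟦ toPoly f ⟧ₚ ρ   ≡⟨ toPoly-correct f ρ ⟩
  ⟦ f ⟧ₑ ρ          ∎
  where open ≡-Reasoning

-- The factorisation

exprRawRing : RawRing 0ℓ 0ℓ
exprRawRing = record
  { Carrier = Expr 9; _≈_ = _≡_; _+_ = _⊕_; _*_ = _⊗_; -_ = ⊝_; 0# = lit 0ℤ; 1# = lit 1ℤ }

open CosetFormulas +-*-rawRing
module Symbolic = CosetFormulas exprRawRing

index : G → Fin 9
index (zero , zero) = zero
index (zero , suc zero) = suc zero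
index (zero , suc (suc zero)) = suc (suc zero)
index (suc zero , zero) = suc (suc (suc zero))
index (suc zero , suc zero) = suc (suc (suc (suc zero)))
index (suc zero , suc (suc zero)) = suc (suc (suc (suc (suc zero))))
index (suc (suc zero) , zero) = suc (suc (suc (suc (suc (suc zero)))))
index (suc (suc zero) , suc zero) = suc (suc (suc (suc (suc (suc (suc zero))))))
index (suc (suc zero) , suc (suc zero)) = suc (suc (suc (suc (suc (suc (suc (suc zero)))))))

enum-index : ∀ g → enum (index g) ≡ g
enum-index (zero , zero) = refl
enum-index (zero , suc zero) = refl
enum-index (zero , suc (suc zero)) = refl
enum-index (suc zero , zero) = refl
enum-index (suc zero , suc zero) = refl
enum-index (suc zero , suc (suc zero)) = refl
enum-index (suc (suc zero) , zero) = refl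
enum-index (suc (suc zero) , suc zero) = refl
enum-index (suc (suc zero) , suc (suc zero)) = refl

coordinates : (G → ℤ) → Vec ℤ 9
coordinates x = tabulate (x ∘ enum)

𝕩 : G → Expr 9
𝕩 g = var (index g)

⟦𝕩⟧ : ∀ x g → ⟦ 𝕩 g ⟧ₑ (coordinates x) ≡ x g
⟦𝕩⟧ x g = trans (lookup∘tabulate (x ∘ enum) (index g)) (cong x (enum-index g))

groupMatrixₚ : Fin 9 → Fin 9 → Poly 9
groupMatrixₚ i j = toPoly (𝕩 (enum i · (enum j ⁻¹)))

⟦groupMatrixₚ⟧ : ∀ x i j → ⟦ groupMatrixₚ i j ⟧ₚ (coordinates x) ≡ x (enum i · (enum j ⁻¹))
⟦groupMatrixₚ⟧ x i j = trans (toPoly-correct (𝕩 (enum i · (enum j ⁻¹))) (coordinates x)) (⟦𝕩⟧ x _)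

factorisedₑ : Expr 9
factorisedₑ = Symbolic.total 𝕩 ⊗ Symbolic.lineNormProduct 𝕩

factorisation-check : isZeroₚ (detₘ 9 groupMatrixₚ -ₚ toPoly factorisedₑ) ≡ true
factorisation-check = refl

det-factorisation : ∀ ρ → det 9 (λ i j → ⟦ groupMatrixₚ i j ⟧ₚ ρ) ≡ ⟦ factorisedₑ ⟧ₑ ρ
det-factorisation ρ = begin
  det 9 (λ i j → ⟦ groupMatrixₚ i j ⟧ₚ ρ)
    ≡⟨ detₘ-homo 9 groupMatrixₚ ρ ⟨
  ⟦ detₘ 9 groupMatrixₚ ⟧ₚ ρ
    ≡⟨ poly-identity (detₘ 9 groupMatrixₚ) (toPoly factorisedₑ) factorisation-check ρ ⟩
  ⟦ toPoly factorisedₑ ⟧ₚ ρ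
    ≡⟨ toPoly-correct factorisedₑ ρ ⟩
  ⟦ factorisedₑ ⟧ₑ ρ
    ∎
  where open ≡-Reasoning

groupDet-factorisation : ∀ x → groupDet x ≡ total x * lineNormProduct x
groupDet-factorisation x = begin
  groupDet x                                            ≡⟨ det-cong 9 (⟦groupMatrixₚ⟧ x) ⟨
  det 9 (λ i j → ⟦ groupMatrixₚ i j ⟧ₚ (coordinates x)) ≡⟨ det-factorisation (coordinates x) ⟩
  total x * lineNormProduct x                           ∎
  where open ≡-Reasoning

lineSum≡total : ∀ x ℓ → lineSum x ℓ ≡ total x
lineSum≡total x line₀₁ = expr-identity (Symbolic.lineSum 𝕩 line₀₁) (Symbolic.total 𝕩) refl (coordinates x)
lineSum≡total x line₁₀ = expr-identity (Symbolic.lineSum 𝕩 line₁₀) (Symbolic.total 𝕩) refl (coordinates x)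
lineSum≡total x line₁₁ = expr-identity (Symbolic.lineSum 𝕩 line₁₁) (Symbolic.total 𝕩) refl (coordinates x)
lineSum≡total x line₁₂ = expr-identity (Symbolic.lineSum 𝕩 line₁₂) (Symbolic.total 𝕩) refl (coordinates x)

-- Two distinct elements lie in a common coset for exactly one of the four lines.
lineσ₂Sum≡3*pairSum : ∀ x → lineσ₂Sum x ≡ + 3 * pairSum 9 (x ∘ enum)
lineσ₂Sum≡3*pairSum x =
  expr-identity (Symbolic.lineσ₂Sum 𝕩) (lit (+ 3) ⊗ Symbolic.pairSum 9 (𝕩 ∘ enum)) refl (coordinates x)

-- Congruences

infix 4 _≡_[mod_]
record _≡_[mod_] (x r n : ℤ) : Set where
  constructor congruent
  field
    quotient : ℤ
    equation : x ≡ n * quotient + r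

+-mod : ∀ {n x y r s} → x ≡ r [mod n ] → y ≡ s [mod n ] → x + y ≡ r + s [mod n ]
+-mod {n} {r = r} {s} (congruent m refl) (congruent m′ refl) = congruent (m + m′) (regroup n m m′ r s)
  where
  regroup : ∀ n m m′ r s → n * m + r + (n * m′ + s) ≡ n * (m + m′) + (r + s)
  regroup = solve-∀

*-mod : ∀ {n x y r s} → x ≡ r [mod n ] → y ≡ s [mod n ] → x * y ≡ r * s [mod n ]
*-mod {n} {r = r} {s} (congruent m refl) (congruent m′ refl) =
  congruent (n * m * m′ + m * s + r * m′) (expand n m m′ r s)
  where
  expand : ∀ n m m′ r s → (n * m + r) * (n * m′ + s) ≡ n * (n * m * m′ + m * s + r * m′) + r * s
  expand = solve-∀

*-mod-0 : ∀ {m n x y} → x ≡ 0ℤ [mod m ] → y ≡ 0ℤ [mod n ] → x * y ≡ 0ℤ [mod m * n ]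
*-mod-0 {m} {n} (congruent k refl) (congruent l refl) = congruent (k * l) (expand m n k l)
  where
  expand : ∀ m n k l → (m * k + 0ℤ) * (n * l + 0ℤ) ≡ m * n * (k * l) + 0ℤ
  expand = solve-∀

≡-mod-trans : ∀ {n x y r} → x ≡ y [mod n ] → y ≡ r [mod n ] → x ≡ r [mod n ]
≡-mod-trans {n} {r = r} (congruent m refl) (congruent m′ refl) = congruent (m + m′) (regroup n m m′ r)
  where
  regroup : ∀ n m m′ r → n * m + (n * m′ + r) ≡ n * (m + m′) + r
  regroup = solve-∀

mod-*⇒mod : ∀ m {n x r} → x ≡ r [mod m * n ] → x ≡ r [mod m ]
mod-*⇒mod m {n} {r = r} (congruent k refl) = congruent (n * k) (regroup m n k r)
  where
  regroup : ∀ m n k r → m * n * k + r ≡ m * (n * k) + r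
  regroup = solve-∀

divMod-congruence : ∀ x d .{{_ : NonZero d}} → x ≡ + (x %ℕ d) [mod + d ]
divMod-congruence x d =
  congruent (x /ℕ d) (trans (a≡a%ℕn+[a/ℕn]*n x d) (commute (x /ℕ d) (+ (x %ℕ d)) (+ d)))
  where
  commute : ∀ q r k → r + q * k ≡ k * q + r
  commute = solve-∀

residue-mod3 : ∀ x → x ≡ 0ℤ [mod + 3 ] ⊎ x ≡ 1ℤ [mod + 3 ] ⊎ x ≡ -1ℤ [mod + 3 ]
residue-mod3 x with x %ℕ 3 | n%ℕd<d x 3 | divMod-congruence x 3
... | 0 | _ | x≡0 = inj₁ x≡0
... | 1 | _ | x≡1 = inj₂ (inj₁ x≡1)
... | 2 | _ | x≡2 = inj₂ (inj₂ (≡-mod-trans x≡2 (congruent 1ℤ refl)))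
... | suc (suc (suc _)) | s≤s (s≤s (s≤s ())) | _

cube : ℤ → ℤ
cube x = x * x * x

cube-mod : ∀ {x r} → x ≡ r [mod + 3 ] → cube x ≡ cube r [mod + 9 ]
cube-mod {r = r} (congruent m refl) = congruent (+ 3 * m * m * m + + 3 * m * m * r + m * r * r) (expand m r)
  where
  expand : ∀ m r → (+ 3 * m + r) * (+ 3 * m + r) * (+ 3 * m + r)
                 ≡ + 9 * (+ 3 * m * m * m + + 3 * m * m * r + m * r * r) + r * r * r
  expand = solve-∀

ninth-power-mod9 : ∀ {x r} → x ≡ r [mod + 3 ] → cube (cube x) ≡ cube (cube r) [mod + 9 ]
ninth-power-mod9 x≡r = cube-mod (mod-*⇒mod (+ 3) {+ 3} (cube-mod x≡r))

square-mod3 : ∀ x → x * x ≡ 0ℤ [mod + 3 ] ⊎ x * x ≡ 1ℤ [mod + 3 ]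
square-mod3 x with residue-mod3 x
... | inj₁ x≡0 = inj₁ (*-mod x≡0 x≡0)
... | inj₂ (inj₁ x≡1) = inj₂ (*-mod x≡1 x≡1)
... | inj₂ (inj₂ x≡-1) = inj₂ (*-mod x≡-1 x≡-1)

ZeroOrMinusOneMod3 : ℤ → Set
ZeroOrMinusOneMod3 e = e ≡ 0ℤ [mod + 3 ] ⊎ e ≡ -1ℤ [mod + 3 ]

σ₂-via-square : ∀ a b c {r} → a + b + c ≡ 0ℤ [mod + 3 ] → (a - b) * (a - b) ≡ r [mod + 3 ] →
  σ₂ a b c ≡ - r [mod + 3 ]
σ₂-via-square a b c {r} (congruent k a+b+c≡) (congruent f [a-b]²≡) =
  congruent (k * (a + b) - a * b - f) (begin
    σ₂ a b c
      ≡⟨ expand a b c ⟩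
    (a + b + c) * (a + b) - + 3 * (a * b) - (a - b) * (a - b)
      ≡⟨ cong₂ (λ s d → s * (a + b) - + 3 * (a * b) - d) a+b+c≡ [a-b]²≡ ⟩
    (+ 3 * k + 0ℤ) * (a + b) - + 3 * (a * b) - (+ 3 * f + r)
      ≡⟨ collect k f a b r ⟩
    + 3 * (k * (a + b) - a * b - f) + - r
      ∎)
  where
  open ≡-Reasoning
  expand : ∀ a b c → a * b + b * c + c * a ≡ (a + b + c) * (a + b) - + 3 * (a * b) - (a - b) * (a - b)
  expand = solve-∀
  collect : ∀ k f a b r → (+ 3 * k + 0ℤ) * (a + b) - + 3 * (a * b) - (+ 3 * f + r)
                        ≡ + 3 * (k * (a + b) - a * b - f) + - r
  collect = solve-∀

σ₂-mod3 : ∀ a b c → a + b + c ≡ 0ℤ [mod + 3 ] → ZeroOrMinusOneMod3 (σ₂ a b c)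
σ₂-mod3 a b c s≡0 with square-mod3 (a - b)
... | inj₁ d²≡0 = inj₁ (σ₂-via-square a b c s≡0 d²≡0)
... | inj₂ d²≡1 = inj₂ (σ₂-via-square a b c s≡0 d²≡1)

sum-of-four-minus-ones : ∀ {e₁ e₂ e₃ e₄} → e₁ ≡ -1ℤ [mod + 3 ] → e₂ ≡ -1ℤ [mod + 3 ] →
  e₃ ≡ -1ℤ [mod + 3 ] → e₄ ≡ -1ℤ [mod + 3 ] → e₁ + e₂ + e₃ + e₄ ≡ 0ℤ [mod + 3 ] → ⊥
sum-of-four-minus-ones h₁ h₂ h₃ h₄ (congruent m Σ≡) with +-mod (+-mod (+-mod h₁ h₂) h₃) h₄
... | congruent m′ Σ≡′ = from-no (+ 3 ∣? + 4) (divides (m′ - m) (begin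
  + 4
    ≡⟨ cancel (+ 3 * m + 0ℤ) ⟩
  (+ 3 * m + 0ℤ) - (+ 3 * m + 0ℤ) + + 4
    ≡⟨ cong (λ y → y - (+ 3 * m + 0ℤ) + + 4) (trans (sym Σ≡) Σ≡′) ⟩
  (+ 3 * m′ + - + 4) - (+ 3 * m + 0ℤ) + + 4
    ≡⟨ collect m m′ ⟩
  (m′ - m) * + 3
    ∎))
  where
  open ≡-Reasoning
  cancel : ∀ y → + 4 ≡ y - y + + 4
  cancel = solve-∀
  collect : ∀ m m′ → (+ 3 * m′ + - + 4) - (+ 3 * m + 0ℤ) + + 4 ≡ (m′ - m) * + 3
  collect = solve-∀

reducedNorm : ℤ → ℤ → ℤ
reducedNorm s e = s * s - + 3 * e

norm≡reducedNorm : ∀ a b c → norm a b c ≡ reducedNorm (a + b + c) (σ₂ a b c)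
norm≡reducedNorm = identity
  where
  identity : ∀ a b c → a * a + b * b + c * c + - (a * b + b * c + c * a)
                     ≡ (a + b + c) * (a + b + c) - + 3 * (a * b + b * c + c * a)
  identity = solve-∀

normProduct : ℤ → ℤ → ℤ → ℤ → ℤ → ℤ
normProduct s e₁ e₂ e₃ e₄ = s * (reducedNorm s e₁ * (reducedNorm s e₂ * (reducedNorm s e₃ * reducedNorm s e₄)))

reducedNorm-mod3 : ∀ {s} e → s ≡ 0ℤ [mod + 3 ] → reducedNorm s e ≡ 0ℤ [mod + 3 ]
reducedNorm-mod3 e (congruent k refl) = congruent (+ 3 * k * k - e) (expand k e)
  where
  expand : ∀ k e → (+ 3 * k + 0ℤ) * (+ 3 * k + 0ℤ) - + 3 * e ≡ + 3 * (+ 3 * k * k - e) + 0ℤ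
  expand = solve-∀

reducedNorm-mod9 : ∀ {s e} → s ≡ 0ℤ [mod + 3 ] → e ≡ 0ℤ [mod + 3 ] → reducedNorm s e ≡ 0ℤ [mod + 9 ]
reducedNorm-mod9 (congruent k refl) (congruent f refl) = congruent (k * k - f) (expand k f)
  where
  expand : ∀ k f → (+ 3 * k + 0ℤ) * (+ 3 * k + 0ℤ) - + 3 * (+ 3 * f + 0ℤ) ≡ + 9 * (k * k - f) + 0ℤ
  expand = solve-∀

normProduct-mod729 : ∀ {s e₁ e₂ e₃ e₄} → s ≡ 0ℤ [mod + 3 ] → e₁ + e₂ + e₃ + e₄ ≡ 0ℤ [mod + 3 ] →
  ZeroOrMinusOneMod3 e₁ → ZeroOrMinusOneMod3 e₂ → ZeroOrMinusOneMod3 e₃ → ZeroOrMinusOneMod3 e₄ →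
  normProduct s e₁ e₂ e₃ e₄ ≡ 0ℤ [mod + 729 ]
normProduct-mod729 {e₁ = e₁} {e₂} {e₃} {e₄} s≡0 _ (inj₁ e₁≡0) _ _ _ =
  *-mod-0 s≡0 (*-mod-0 (reducedNorm-mod9 s≡0 e₁≡0)
    (*-mod-0 (reducedNorm-mod3 e₂ s≡0) (*-mod-0 (reducedNorm-mod3 e₃ s≡0) (reducedNorm-mod3 e₄ s≡0))))
normProduct-mod729 {e₁ = e₁} {e₂} {e₃} {e₄} s≡0 _ (inj₂ _) (inj₁ e₂≡0) _ _ =
  *-mod-0 s≡0 (*-mod-0 (reducedNorm-mod3 e₁ s≡0)
    (*-mod-0 (reducedNorm-mod9 s≡0 e₂≡0) (*-mod-0 (reducedNorm-mod3 e₃ s≡0) (reducedNorm-mod3 e₄ s≡0))))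
normProduct-mod729 {e₁ = e₁} {e₂} {e₃} {e₄} s≡0 _ (inj₂ _) (inj₂ _) (inj₁ e₃≡0) _ =
  *-mod-0 s≡0 (*-mod-0 (reducedNorm-mod3 e₁ s≡0)
    (*-mod-0 (reducedNorm-mod3 e₂ s≡0) (*-mod-0 (reducedNorm-mod9 s≡0 e₃≡0) (reducedNorm-mod3 e₄ s≡0))))
normProduct-mod729 {e₁ = e₁} {e₂} {e₃} {e₄} s≡0 _ (inj₂ _) (inj₂ _) (inj₂ _) (inj₁ e₄≡0) =
  *-mod-0 s≡0 (*-mod-0 (reducedNorm-mod3 e₁ s≡0)
    (*-mod-0 (reducedNorm-mod3 e₂ s≡0) (*-mod-0 (reducedNorm-mod3 e₃ s≡0) (reducedNorm-mod9 s≡0 e₄≡0))))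
normProduct-mod729 _ Σ≡0 (inj₂ h₁) (inj₂ h₂) (inj₂ h₃) (inj₂ h₄) =
  ⊥-elim (sum-of-four-minus-ones h₁ h₂ h₃ h₄ Σ≡0)

normProduct≡ninthPower : ∀ s {e₁ e₂ e₃ e₄} → e₁ + e₂ + e₃ + e₄ ≡ 0ℤ [mod + 3 ] →
  normProduct s e₁ e₂ e₃ e₄ ≡ cube (cube s) [mod + 9 ]
normProduct≡ninthPower s {e₁} {e₂} {e₃} {e₄} (congruent σ Σ≡) = congruent (r - s⁷ * σ) (begin
  normProduct s e₁ e₂ e₃ e₄
    ≡⟨ expand s (s * s) e₁ e₂ e₃ e₄ ⟩
  s⁷ * (s * s) - + 3 * s⁷ * (e₁ + e₂ + e₃ + e₄) + + 9 * r
    ≡⟨ cong₂ (λ p t → p - + 3 * s⁷ * t + + 9 * r) (ninth s) Σ≡ ⟩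
  cube (cube s) - + 3 * s⁷ * (+ 3 * σ + 0ℤ) + + 9 * r
    ≡⟨ collect (cube (cube s)) s⁷ σ r ⟩
  + 9 * (r - s⁷ * σ) + cube (cube s)
    ∎)
  where
  open ≡-Reasoning
  s⁷ = s * (s * s) * (s * s) * (s * s)
  rest : ℤ → ℤ → ℤ → ℤ → ℤ → ℤ → ℤ
  rest s u a b c d = s * u * u * (a * b + a * c + a * d + b * c + b * d + c * d)
                   - + 3 * s * u * (a * b * c + a * b * d + a * c * d + b * c * d) + + 9 * s * (a * b * c * d)
  r = rest s (s * s) e₁ e₂ e₃ e₄
  -- u stands for s², which keeps the identity of low degree for the solver
  expand : ∀ s u a b c d → s * ((u - + 3 * a) * ((u - + 3 * b) * ((u - + 3 * c) * (u - + 3 * d))))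
         ≡ s * u * u * u * u - + 3 * (s * u * u * u) * (a + b + c + d)
           + + 9 * (s * u * u * (a * b + a * c + a * d + b * c + b * d + c * d)
                    - + 3 * s * u * (a * b * c + a * b * d + a * c * d + b * c * d) + + 9 * s * (a * b * c * d))
  expand = solve-∀
  ninth : ∀ s → s * (s * s) * (s * s) * (s * s) * (s * s) ≡ s * s * s * (s * s * s) * (s * s * s)
  ninth = solve-∀
  collect : ∀ p q σ r → p - + 3 * q * (+ 3 * σ + 0ℤ) + + 9 * r ≡ + 9 * (r - q * σ) + p
  collect = solve-∀

normProduct-mod9 : ∀ {s r e₁ e₂ e₃ e₄} → s ≡ r [mod + 3 ] → e₁ + e₂ + e₃ + e₄ ≡ 0ℤ [mod + 3 ] →
  normProduct s e₁ e₂ e₃ e₄ ≡ cube (cube r) [mod + 9 ]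
normProduct-mod9 {s} s≡r Σ≡0 = ≡-mod-trans (normProduct≡ninthPower s Σ≡0) (ninth-power-mod9 s≡r)

Values : ℤ → Set
Values d = (∃[ m ] (d ≡ + 9 * m + + 1 ⊎ d ≡ + 9 * m - + 1)) ⊎ (∃[ m ] d ≡ + 729 * m)

mod9⇒Values : ∀ {d} → d ≡ 1ℤ [mod + 9 ] ⊎ d ≡ -1ℤ [mod + 9 ] → Values d
mod9⇒Values (inj₁ (congruent m d≡)) = inj₁ (m , inj₁ d≡)
mod9⇒Values (inj₂ (congruent m d≡)) = inj₁ (m , inj₂ d≡)

mod729⇒Values : ∀ {d} → d ≡ 0ℤ [mod + 729 ] → Values d
mod729⇒Values (congruent m d≡) = inj₂ (m , trans d≡ (+-identityʳ _))

normProduct-values : ∀ s e₁ e₂ e₃ e₄ → e₁ + e₂ + e₃ + e₄ ≡ 0ℤ [mod + 3 ] →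
  (s ≡ 0ℤ [mod + 3 ] →
    ZeroOrMinusOneMod3 e₁ × ZeroOrMinusOneMod3 e₂ × ZeroOrMinusOneMod3 e₃ × ZeroOrMinusOneMod3 e₄) →
  Values (normProduct s e₁ e₂ e₃ e₄)
normProduct-values s e₁ e₂ e₃ e₄ Σ≡0 residues = case residue-mod3 s of λ where
  (inj₁ s≡0) → let (r₁ , r₂ , r₃ , r₄) = residues s≡0 in
    mod729⇒Values (normProduct-mod729 s≡0 Σ≡0 r₁ r₂ r₃ r₄)
  (inj₂ (inj₁ s≡1)) → mod9⇒Values (inj₁ (normProduct-mod9 s≡1 Σ≡0))
  (inj₂ (inj₂ s≡-1)) → mod9⇒Values (inj₂ (normProduct-mod9 s≡-1 Σ≡0))

lineNorm≡reducedNorm : ∀ x ℓ → lineNorm x ℓ ≡ reducedNorm (total x) (lineσ₂ x ℓ)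
lineNorm≡reducedNorm x ℓ = trans (norm≡reducedNorm (cosetSum x ℓ 𝟙) (cosetSum x ℓ t) (cosetSum x ℓ (t · t)))
  (cong (λ s → reducedNorm s (lineσ₂ x ℓ)) (lineSum≡total x ℓ))
  where t = transversal ℓ

groupDet≡normProduct : ∀ x → groupDet x ≡
  normProduct (total x) (lineσ₂ x line₀₁) (lineσ₂ x line₁₀) (lineσ₂ x line₁₁) (lineσ₂ x line₁₂)
groupDet≡normProduct x = trans (groupDet-factorisation x)
  (cong (total x *_) (cong₂ _*_ (ρ line₀₁) (cong₂ _*_ (ρ line₁₀) (cong₂ _*_ (ρ line₁₁) (ρ line₁₂)))))
  where ρ = lineNorm≡reducedNorm x

lineσ₂Sum-mod3 : ∀ x → lineσ₂Sum x ≡ 0ℤ [mod + 3 ]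
lineσ₂Sum-mod3 x = congruent (pairSum 9 (x ∘ enum)) (trans (lineσ₂Sum≡3*pairSum x) (sym (+-identityʳ _)))

lineσ₂-mod3 : ∀ x ℓ → total x ≡ 0ℤ [mod + 3 ] → ZeroOrMinusOneMod3 (lineσ₂ x ℓ)
lineσ₂-mod3 x ℓ s≡0 = σ₂-mod3 (cosetSum x ℓ 𝟙) (cosetSum x ℓ t) (cosetSum x ℓ (t · t))
  (subst (_≡ 0ℤ [mod + 3 ]) (sym (lineSum≡total x ℓ)) s≡0)
  where t = transversal ℓ

groupDet-values : ∀ x → Values (groupDet x)
groupDet-values x = subst Values (sym (groupDet≡normProduct x))
  (normProduct-values (total x) _ _ _ _ (lineσ₂Sum-mod3 x) λ s≡0 →
    lineσ₂-mod3 x line₀₁ s≡0 , lineσ₂-mod3 x line₁₀ s≡0 ,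
    lineσ₂-mod3 x line₁₁ s≡0 , lineσ₂-mod3 x line₁₂ s≡0)

-- Realising the values

translate : ℤ → (G → ℤ) → G → ℤ
translate q δ g = q + δ g

sum-translate : ∀ n q (f : Fin n → ℤ) → sum n (λ i → q + f i) ≡ + n * q + sum n f
sum-translate zero q f = refl
sum-translate (suc n) q f = begin
  q + f zero + sum n (λ i → q + f (suc i)) ≡⟨ cong (λ s → q + f zero + s) (sum-translate n q (f ∘ suc)) ⟩
  q + f zero + (+ n * q + sum n (f ∘ suc)) ≡⟨ regroup q (f zero) (+ n) (sum n (f ∘ suc)) ⟩
  q + + n * q + (f zero + sum n (f ∘ suc)) ≡⟨ cong (_+ sum (suc n) f) (suc-* (+ n) q) ⟨
  + suc n * q + sum (suc n) f              ∎
  where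
  open ≡-Reasoning
  regroup : ∀ q a n s → q + a + (n * q + s) ≡ q + n * q + (a + s)
  regroup = solve-∀

cosetSum-translate : ∀ q δ ℓ g → cosetSum (translate q δ) ℓ g ≡ cosetSum δ ℓ g + + 3 * q
cosetSum-translate q δ ℓ g = regroup q _ _ _
  where
  regroup : ∀ q a b c → q + a + (q + b) + (q + c) ≡ a + b + c + + 3 * q
  regroup = solve-∀

norm-translate : ∀ a b c t → norm (a + t) (b + t) (c + t) ≡ norm a b c
norm-translate = identity
  where
  identity : ∀ a b c t → (a + t) * (a + t) + (b + t) * (b + t) + (c + t) * (c + t)
                         + - ((a + t) * (b + t) + (b + t) * (c + t) + (c + t) * (a + t))
                       ≡ a * a + b * b + c * c + - (a * b + b * c + c * a)
  identity = solve-∀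

lineNorm-translate : ∀ q δ ℓ → lineNorm (translate q δ) ℓ ≡ lineNorm δ ℓ
lineNorm-translate q δ ℓ = trans
  (norm-cong (cosetSum-translate q δ ℓ 𝟙) (cosetSum-translate q δ ℓ t) (cosetSum-translate q δ ℓ (t · t)))
  (norm-translate (cosetSum δ ℓ 𝟙) (cosetSum δ ℓ t) (cosetSum δ ℓ (t · t)) (+ 3 * q))
  where
  t = transversal ℓ
  norm-cong : ∀ {a b c a′ b′ c′} → a ≡ a′ → b ≡ b′ → c ≡ c′ → norm a b c ≡ norm a′ b′ c′
  norm-cong refl refl refl = refl

groupDet-translate : ∀ q δ → groupDet (translate q δ) ≡ (+ 9 * q + total δ) * lineNormProduct δ
groupDet-translate q δ = trans (groupDet-factorisation (translate q δ))
  (cong₂ _*_ (sum-translate 9 q (δ ∘ enum))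
    (cong₂ _*_ (ν line₀₁) (cong₂ _*_ (ν line₁₀) (cong₂ _*_ (ν line₁₁) (ν line₁₂)))))
  where ν = lineNorm-translate q δ

realises-mod9 : ∀ q δ {r} → total δ ≡ r → lineNormProduct δ ≡ 1ℤ → groupDet (translate q δ) ≡ + 9 * q + r
realises-mod9 q δ refl ν≡1 =
  trans (groupDet-translate q δ) (trans (cong (λ ν → (+ 9 * q + total δ) * ν) ν≡1) (*-identityʳ _))

realises-mod729 : ∀ q δ r → total δ ≡ + 3 * r → lineNormProduct δ ≡ + 243 →
  groupDet (translate q δ) ≡ + 729 * (+ 3 * q + r)
realises-mod729 q δ r total≡ ν≡243 =
  trans (groupDet-translate q δ) (trans (cong₂ (λ t ν → (+ 9 * q + t) * ν) total≡ ν≡243) (regroup q r))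
  where
  regroup : ∀ q r → (+ 9 * q + + 3 * r) * + 243 ≡ + 729 * (+ 3 * q + r)
  regroup = solve-∀

fromCoordinates : Vec ℤ 9 → G → ℤ
fromCoordinates v g = lookup v (index g)

unitAt𝟙 : ℤ → G → ℤ
unitAt𝟙 r = fromCoordinates (r ∷ 0ℤ ∷ 0ℤ ∷ 0ℤ ∷ 0ℤ ∷ 0ℤ ∷ 0ℤ ∷ 0ℤ ∷ 0ℤ ∷ [])

δ₀ δ₊ δ₋ : G → ℤ
δ₀ = fromCoordinates (-1ℤ ∷ -1ℤ ∷ 0ℤ ∷ 0ℤ ∷ 0ℤ ∷ 1ℤ ∷ 0ℤ ∷ 1ℤ ∷ 0ℤ ∷ [])
δ₊ = fromCoordinates (1ℤ ∷ 1ℤ ∷ 1ℤ ∷ 1ℤ ∷ 0ℤ ∷ -1ℤ ∷ 0ℤ ∷ 0ℤ ∷ 0ℤ ∷ [])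
δ₋ = fromCoordinates (-1ℤ ∷ -1ℤ ∷ -1ℤ ∷ -1ℤ ∷ 0ℤ ∷ 1ℤ ∷ 0ℤ ∷ 0ℤ ∷ 0ℤ ∷ [])

values⇒InS : ∀ {d} → Values d → InS d
values⇒InS (inj₁ (m , inj₁ refl)) = translate m (unitAt𝟙 1ℤ) , realises-mod9 m (unitAt𝟙 1ℤ) refl refl
values⇒InS (inj₁ (m , inj₂ refl)) = translate m (unitAt𝟙 -1ℤ) , realises-mod9 m (unitAt𝟙 -1ℤ) refl refl
values⇒InS (inj₂ (m , refl)) = case residue-mod3 m of λ where
  (inj₁ (congruent q refl)) → translate q δ₀ , realises-mod729 q δ₀ 0ℤ refl refl
  (inj₂ (inj₁ (congruent q refl))) → translate q δ₊ , realises-mod729 q δ₊ 1ℤ refl refl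
  (inj₂ (inj₂ (congruent q refl))) → translate q δ₋ , realises-mod729 q δ₋ -1ℤ refl refl

theorem6p1 : ∀ (d : ℤ) →
    InS d ⇔ ((∃[ m ] (d ≡ + 9 * m + + 1 ⊎ d ≡ + 9 * m - + 1)) ⊎ (∃[ m ] d ≡ + 729 * m))
theorem6p1 d = mk⇔ (λ { (x , refl) → groupDet-values x }) values⇒InS
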